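{- Let $\mathcal{V}$ be a coherent variety of $\mathcal{L}$-algebras (where the signature $\mathcal{L}$ contains at least one constant symbol) with a term-definable join-semilattice reduct, and let $t(x,\bar{u})$ be a term satisfying \[ \mathcal{V} \models x \le t(x,\bar{u}) \quad \text{and} \quad \mathcal{V} \models x \le y \Rightarrow t(x,\bar{u}) \le t(y,\bar{u}). \] Suppose also that $\mathcal{V}$ satisfies the following fixpoint embedding condition with respect to $t(x,\bar{u})$: for any finitely generated $\mathbf{A}\in\mathcal{V}$ and elements $a,\bar{b}\in A$, there exists an algebra $\mathbf{B}\in\mathcal{V}$ such that $\mathbf{A}$ is a subalgebra of $\mathbf{B}$, the join $\bigvee_{k\in\mathbb{N}} t^k(a,\bar{b})$ exists in $\mathbf{B}$, and \[ \bigvee_{k\in\mathbb{N}} t^k(a,\bar{b}) = t\Big(\bigvee_{k\in\mathbb{N}} t^k(a,\bar{b}),\bar{b}\Big). \] Then $\mathcal{V}\models t^{n}(x,\bar{u}) \approx t^{n+1}(x,\bar{u})$ for some $n\in\mathbb{N}$.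
   Context: The order $\le$ is the one of the term-definable join-semilattice reduct ($s\le r$ abbreviates $s\vee r\approx r$). Iterates are defined by $t^0(x,\bar{u}) := x$ and $t^{k+1}(x,\bar{u}) := t(t^k(x,\bar{u}),\bar{u})$. An algebra $\mathbf{A}\in\mathcal{V}$ is finitely presented (in $\mathcal{V}$) if it is isomorphic to $\mathbf{F}(\bar{x})/\Theta$ for some finite set of variables $\bar{x}$, where $\mathbf{F}(\bar{x})$ is the free algebra of $\mathcal{V}$ over $\bar{x}$, and $\Theta$ is a compact (finitely generated) congruence on $\mathbf{F}(\bar{x})$. The variety $\mathcal{V}$ is coherent if every finitely generated subalgebra of a finitely presented member of $\mathcal{V}$ is itself finitely presented. -}

module Defs where

open import Data.Nat using (ℕ; zero; suc)
open import Data.Fin using (Fin; zero; suc)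
open import Data.Product using (Σ; Σ-syntax; _×_; _,_; proj₁; proj₂)
open import Relation.Binary.Structures using (IsEquivalence)

record Signature : Set₁ where
  field
    Op : Set
    ar : Op → ℕ
open Signature public

cons : ∀ {A : Set} {m : ℕ} → A → (Fin m → A) → Fin (suc m) → A
cons a b zero = a
cons a b (suc i) = b i

pair : ∀ {A : Set} → A → A → Fin 2 → A
pair a b zero = a
pair a b (suc _) = b

module _ (L : Signature) where

  data Term (X : Set) : Set where
    var : X → Term X
    app : (f : Op L) → (Fin (ar L f) → Term X) → Term X

  _⟪_⟫ : ∀ {X Y : Set} → Term X → (X → Term Y) → Term Y
  var x ⟪ σ ⟫ = σ x
  app f ts ⟪ σ ⟫ = app f (λ i → ts i ⟪ σ ⟫)

  -- Algebras (setoid-based, since there are no quotient types).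
  record Algebra : Set₁ where
    field
      Carrier : Set
      _≈_ : Carrier → Carrier → Set
      isEquivalence : IsEquivalence _≈_
      op : (f : Op L) → (Fin (ar L f) → Carrier) → Carrier
      op-cong : ∀ f {as bs : Fin (ar L f) → Carrier} →
                (∀ i → as i ≈ bs i) → op f as ≈ op f bs

    ⟦_⟧ : ∀ {X : Set} → Term X → (X → Carrier) → Carrier
    ⟦ var x ⟧ ρ = ρ x
    ⟦ app f ts ⟧ ρ = op f (λ i → ⟦ ts i ⟧ ρ)

  open Algebra public

  -- A variety, given by a set of defining identities (Birkhoff).
  record Variety : Set₁ where
    field
      Ax : Set
      lhs : Ax → Term ℕ
      rhs : Ax → Term ℕ
  open Variety public

  _∈V_ : Algebra → Variety → Set
  A ∈V V = ∀ (e : Ax V) (ρ : ℕ → Carrier A) →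
           _≈_ A (⟦_⟧ A (lhs V e) ρ) (⟦_⟧ A (rhs V e) ρ)

  _⊨_≈ᵗ_ : Variety → ∀ {X : Set} → Term X → Term X → Set₁
  V ⊨ s ≈ᵗ r = ∀ (A : Algebra) → A ∈V V → ∀ ρ → _≈_ A (⟦_⟧ A s ρ) (⟦_⟧ A r ρ)

  record Hom (A B : Algebra) : Set where
    field
      fun : Carrier A → Carrier B
      fun-cong : ∀ {x y} → _≈_ A x y → _≈_ B (fun x) (fun y)
      fun-hom : ∀ (f : Op L) (as : Fin (ar L f) → Carrier A) →
                _≈_ B (fun (op A f as)) (op B f (λ i → fun (as i)))
  open Hom public

  IsEmbedding : {A B : Algebra} → Hom A B → Set
  IsEmbedding {A} {B} h = ∀ x y → _≈_ B (fun h x) (fun h y) → _≈_ A x y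

  record Iso (A B : Algebra) : Set where
    field
      to : Hom A B
      from : Hom B A
      to-from : ∀ b → _≈_ B (fun to (fun from b)) b
      from-to : ∀ a → _≈_ A (fun from (fun to a)) a

  -- Congruence on Term (Fin n) generated by the equational theory of V
  -- together with finitely many pairs R; i.e. F(x̄)/Θ with Θ = Cg(R),
  -- a compact congruence of the free algebra F(x̄) of V.
  data PresEq (V : Variety) (n k : ℕ) (R : Fin k → Term (Fin n) × Term (Fin n))
         : Term (Fin n) → Term (Fin n) → Set where
    ax    : ∀ (e : Ax V) (σ : ℕ → Term (Fin n)) →
            PresEq V n k R (lhs V e ⟪ σ ⟫) (rhs V e ⟪ σ ⟫)
    gen   : ∀ (i : Fin k) → PresEq V n k R (proj₁ (R i)) (proj₂ (R i))
    refl′ : ∀ {s} → PresEq V n k R s s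
    sym′  : ∀ {s r} → PresEq V n k R s r → PresEq V n k R r s
    trans′ : ∀ {s r u} → PresEq V n k R s r → PresEq V n k R r u → PresEq V n k R s u
    cong′ : ∀ (f : Op L) {ss rs : Fin (ar L f) → Term (Fin n)} →
            (∀ i → PresEq V n k R (ss i) (rs i)) → PresEq V n k R (app f ss) (app f rs)

  Presented : (V : Variety) (n k : ℕ) (R : Fin k → Term (Fin n) × Term (Fin n)) → Algebra
  Presented V n k R = record
    { Carrier = Term (Fin n)
    ; _≈_ = PresEq V n k R
    ; isEquivalence = record { refl = refl′ ; sym = sym′ ; trans = trans′ }
    ; op = app
    ; op-cong = cong′
    }

  IsFP : Variety → Algebra → Set
  IsFP V A = Σ[ n ∈ ℕ ] Σ[ k ∈ ℕ ] Σ[ R ∈ (Fin k → Term (Fin n) × Term (Fin n)) ]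
               Iso A (Presented V n k R)

  FinGen : Algebra → Set
  FinGen A = Σ[ n ∈ ℕ ] Σ[ g ∈ (Fin n → Carrier A) ]
               (∀ a → Σ[ s ∈ Term (Fin n) ] _≈_ A a (⟦_⟧ A s g))

  Sg : (A : Algebra) {n : ℕ} → (Fin n → Carrier A) → Algebra
  Sg A {n} g = record
    { Carrier = Σ[ a ∈ Carrier A ] Σ[ s ∈ Term (Fin n) ] _≈_ A a (⟦_⟧ A s g)
    ; _≈_ = λ x y → _≈_ A (proj₁ x) (proj₁ y)
    ; isEquivalence = record
        { refl = IsEquivalence.refl (isEquivalence A)
        ; sym = IsEquivalence.sym (isEquivalence A)
        ; trans = IsEquivalence.trans (isEquivalence A) }
    ; op = λ f xs → op A f (λ i → proj₁ (xs i))
                  , app f (λ i → proj₁ (proj₂ (xs i)))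
                  , op-cong A f (λ i → proj₂ (proj₂ (xs i)))
    ; op-cong = λ f eqs → op-cong A f eqs
    }

  Coherent : Variety → Set₁
  Coherent V = ∀ (A : Algebra) → IsFP V A →
               ∀ (n : ℕ) (g : Fin n → Carrier A) → IsFP V (Sg A g)

  _∨⟨_⟩_ : ∀ {X : Set} → Term X → Term (Fin 2) → Term X → Term X
  s ∨⟨ J ⟩ r = J ⟪ pair s r ⟫

  v0 v1 v2 : Term (Fin 3)
  v0 = var zero
  v1 = var (suc zero)
  v2 = var (suc (suc zero))

  IsJoinTerm : Variety → Term (Fin 2) → Set₁
  IsJoinTerm V J =
      (V ⊨ (v0 ∨⟨ J ⟩ v0) ≈ᵗ v0)
    × (V ⊨ (v0 ∨⟨ J ⟩ v1) ≈ᵗ (v1 ∨⟨ J ⟩ v0))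
    × (V ⊨ ((v0 ∨⟨ J ⟩ v1) ∨⟨ J ⟩ v2) ≈ᵗ (v0 ∨⟨ J ⟩ (v1 ∨⟨ J ⟩ v2)))

  Leq : (A : Algebra) → Term (Fin 2) → Carrier A → Carrier A → Set
  Leq A J a b = _≈_ A (⟦_⟧ A J (pair a b)) b

  iter : ∀ {m : ℕ} → Term (Fin (suc m)) → ℕ → Term (Fin (suc m))
  iter t zero = var zero
  iter t (suc k) = t ⟪ cons (iter t k) (λ i → var (suc i)) ⟫

  IsSup : (A : Algebra) → Term (Fin 2) → (ℕ → Carrier A) → Carrier A → Set
  IsSup A J f s = (∀ k → Leq A J (f k) s)
                × (∀ c → (∀ k → Leq A J (f k) c) → Leq A J s c)

  FixpointEmbedding : Variety → Term (Fin 2) → ∀ {m : ℕ} → Term (Fin (suc m)) → Set₁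
  FixpointEmbedding V J {m} t =
    ∀ (A : Algebra) → A ∈V V → FinGen A →
    ∀ (a : Carrier A) (b : Fin m → Carrier A) →
    Σ[ B ∈ Algebra ] (B ∈V V × Σ[ h ∈ Hom A B ] (IsEmbedding h ×
      Σ[ s ∈ Carrier B ]
        (IsSup B J (λ k → ⟦_⟧ B (iter t k) (cons (fun h a) (λ i → fun h (b i)))) s
        × _≈_ B s (⟦_⟧ B t (cons s (λ i → fun h (b i)))))))

-- Present A by generators y, z, x, ū subject to x ≤ y, t(y,ū) ≤ y and y ≤ z. By monotonicity
-- t^k(x,ū) ≤ y ≤ z in A for every k. Coherence makes the subalgebra of A generated by z, x, ū
-- finitely presented, so its relations follow from finitely many of them. Let Q be F(z,x,ū) modulo
-- all t^k(x,ū) ≤ z. The fixpoint embedding extends Q by a fixpoint ŷ = ⋁ t^k(x,ū) ≤ z, and sending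
-- y to ŷ shows that every relation of the subalgebra holds in Q. Being finitely many, they follow
-- from t^i(x,ū) ≤ z for i ≤ N; in particular t^(N+1)(x,ū) ≤ z does, and substituting t^N(x,ū)
-- for z yields t^(N+1) ≤ t^N, while t^N ≤ t^(N+1) since t is inflationary.
module Submission where

open import Defs
open import Data.Nat using (ℕ; zero; suc; _≤_; _≤′_; ≤′-refl; ≤′-step; _⊔_)
open import Data.Nat.Properties using (≤⇒≤′; ≤-refl; ≤-trans; m≤m⊔n; m≤n⊔m)
open import Data.Fin using (Fin; zero; suc)
open import Data.Sum using (_⊎_; inj₁; inj₂)
open import Data.Product using (Σ; Σ-syntax; _×_; _,_; proj₁; proj₂)
open import Relation.Binary.Bundles using (Setoid)
open import Relation.Binary.Core using (Rel)
open import Relation.Binary.Definitions using (Reflexive; Transitive)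
open import Relation.Binary.PropositionalEquality using (_≡_)
open import Relation.Binary.Structures using (IsEquivalence)
import Relation.Binary.Reasoning.Setoid as SetoidReasoning

UpwardClosed : {I : Set} → (I → ℕ → Set) → Set
UpwardClosed P = ∀ i {N N′} → N ≤ N′ → P i N → P i N′

CommonBound : Set → Set₁
CommonBound I = ∀ {P : I → ℕ → Set} → UpwardClosed P → (∀ i → Σ ℕ (P i)) → Σ[ N ∈ ℕ ] (∀ i → P i N)

Fin-commonBound : ∀ K → CommonBound (Fin K)
Fin-commonBound zero    upward bound = 0 , λ ()
Fin-commonBound (suc K) upward bound
  with bound zero | Fin-commonBound K (λ i → upward (suc i)) (λ i → bound (suc i))
... | N₀ , p₀ | N₁ , p₁ = N₀ ⊔ N₁ , λ where
  zero    → upward zero    (m≤m⊔n N₀ N₁) p₀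
  (suc i) → upward (suc i) (m≤n⊔m N₀ N₁) (p₁ i)

⊎-commonBound : ∀ {I I′} → CommonBound I → CommonBound I′ → CommonBound (I ⊎ I′)
⊎-commonBound bounded bounded′ upward bound
  with bounded (λ i → upward (inj₁ i)) (λ i → bound (inj₁ i))
     | bounded′ (λ i → upward (inj₂ i)) (λ i → bound (inj₂ i))
... | N₀ , p₀ | N₁ , p₁ = N₀ ⊔ N₁ , λ where
  (inj₁ i) → upward (inj₁ i) (m≤m⊔n N₀ N₁) (p₀ i)
  (inj₂ i) → upward (inj₂ i) (m≤n⊔m N₀ N₁) (p₁ i)

ascending⇒monotone : ∀ {a ℓ} {A : Set a} {_≲_ : Rel A ℓ} → Reflexive _≲_ → Transitive _≲_ →
                     (f : ℕ → A) → (∀ k → f k ≲ f (suc k)) → ∀ {i j} → i ≤ j → f i ≲ f j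
ascending⇒monotone {_≲_ = _≲_} refl trans f step i≤j = go (≤⇒≤′ i≤j)
  where
  go : ∀ {i j} → i ≤′ j → f i ≲ f j
  go ≤′-refl        = refl
  go (≤′-step i≤j) = trans (go i≤j) (step _)

module Equational (L : Signature) where

  infixl 8 _[_]
  _[_] : ∀ {X Y : Set} → Term L X → (X → Term L Y) → Term L Y
  s [ σ ] = _⟪_⟫ L s σ

  data Derivable (V : Variety L) {X I : Set} (P : I → Term L X × Term L X)
       : Term L X → Term L X → Set where
    axiom      : ∀ e (σ : ℕ → Term L X) → Derivable V P (lhs V e [ σ ]) (rhs V e [ σ ])
    assumption : ∀ i → Derivable V P (proj₁ (P i)) (proj₂ (P i))
    refl       : ∀ {s} → Derivable V P s s
    sym        : ∀ {s r} → Derivable V P s r → Derivable V P r s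
    trans      : ∀ {s r u} → Derivable V P s r → Derivable V P r u → Derivable V P s u
    app-cong   : ∀ f {ss rs : Fin (ar L f) → Term L X} →
                 (∀ i → Derivable V P (ss i) (rs i)) → Derivable V P (app f ss) (app f rs)

  Derivable-setoid : (V : Variety L) {X I : Set} (P : I → Term L X × Term L X) → Setoid _ _
  Derivable-setoid V P = record
    { _≈_ = Derivable V P ; isEquivalence = record { refl = refl ; sym = sym ; trans = trans } }

  module _ {V : Variety L} where

    subst-var : ∀ {X I} {P : I → Term L X × Term L X} (s : Term L X) → Derivable V P (s [ var ]) s
    subst-var (var x)    = refl
    subst-var (app f ts) = app-cong f λ i → subst-var (ts i)

    subst-cong : ∀ {X Y I} {P : I → Term L Y × Term L Y} (s : Term L X) {σ σ′ : X → Term L Y} →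
                 (∀ x → Derivable V P (σ x) (σ′ x)) → Derivable V P (s [ σ ]) (s [ σ′ ])
    subst-cong (var x)    σ≈σ′ = σ≈σ′ x
    subst-cong (app f ts) σ≈σ′ = app-cong f λ i → subst-cong (ts i) σ≈σ′

    subst-assoc : ∀ {X Y Z I} {P : I → Term L Z × Term L Z} (s : Term L X)
                  (σ : X → Term L Y) (τ : Y → Term L Z) →
                  Derivable V P (s [ σ ] [ τ ]) (s [ (λ x → σ x [ τ ]) ])
    subst-assoc (var x)    σ τ = refl
    subst-assoc (app f ts) σ τ = app-cong f λ i → subst-assoc (ts i) σ τ

    Derivable-subst : ∀ {X Y I I′} {P : I → Term L X × Term L X} {P′ : I′ → Term L Y × Term L Y}
                      (τ : X → Term L Y) →
                      (∀ i → Derivable V P′ (proj₁ (P i) [ τ ]) (proj₂ (P i) [ τ ])) →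
                      ∀ {s r} → Derivable V P s r → Derivable V P′ (s [ τ ]) (r [ τ ])
    Derivable-subst τ P[τ] (axiom e σ) =
      trans (subst-assoc (lhs V e) σ τ)
            (trans (axiom e λ x → σ x [ τ ]) (sym (subst-assoc (rhs V e) σ τ)))
    Derivable-subst τ P[τ] (assumption i) = P[τ] i
    Derivable-subst τ P[τ] refl           = refl
    Derivable-subst τ P[τ] (sym p)        = sym (Derivable-subst τ P[τ] p)
    Derivable-subst τ P[τ] (trans p q)    = trans (Derivable-subst τ P[τ] p) (Derivable-subst τ P[τ] q)
    Derivable-subst τ P[τ] (app-cong f p) = app-cong f λ i → Derivable-subst τ P[τ] (p i)

    Derivable-mono : ∀ {X I I′} {P : I → Term L X × Term L X} {P′ : I′ → Term L X × Term L X} →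
                     (∀ i → Derivable V P′ (proj₁ (P i)) (proj₂ (P i))) →
                     ∀ {s r} → Derivable V P s r → Derivable V P′ s r
    Derivable-mono P⊆P′ (axiom e σ)    = axiom e σ
    Derivable-mono P⊆P′ (assumption i) = P⊆P′ i
    Derivable-mono P⊆P′ refl           = refl
    Derivable-mono P⊆P′ (sym p)        = sym (Derivable-mono P⊆P′ p)
    Derivable-mono P⊆P′ (trans p q)    = trans (Derivable-mono P⊆P′ p) (Derivable-mono P⊆P′ q)
    Derivable-mono P⊆P′ (app-cong f p) = app-cong f λ i → Derivable-mono P⊆P′ (p i)

    PresEq⇒Derivable : ∀ {n k R s r} → PresEq L V n k R s r → Derivable V R s r
    PresEq⇒Derivable (ax e σ)     = axiom e σ
    PresEq⇒Derivable (gen i)      = assumption i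
    PresEq⇒Derivable refl′        = refl
    PresEq⇒Derivable (sym′ p)     = sym (PresEq⇒Derivable p)
    PresEq⇒Derivable (trans′ p q) = trans (PresEq⇒Derivable p) (PresEq⇒Derivable q)
    PresEq⇒Derivable (cong′ f p)  = app-cong f λ i → PresEq⇒Derivable (p i)

    Derivable⇒PresEq : ∀ {n k R s r} → Derivable V R s r → PresEq L V n k R s r
    Derivable⇒PresEq (axiom e σ)    = ax e σ
    Derivable⇒PresEq (assumption i) = gen i
    Derivable⇒PresEq refl           = refl′
    Derivable⇒PresEq (sym p)        = sym′ (Derivable⇒PresEq p)
    Derivable⇒PresEq (trans p q)    = trans′ (Derivable⇒PresEq p) (Derivable⇒PresEq q)
    Derivable⇒PresEq (app-cong f p) = cong′ f λ i → Derivable⇒PresEq (p i)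

    ⟦⟧-Presented : ∀ {n k R} {Y : Set} (s : Term L Y) (σ : Y → Term L (Fin n)) →
                   PresEq L V n k R (⟦_⟧ (Presented L V n k R) s σ) (s [ σ ])
    ⟦⟧-Presented (var x)    σ = refl′
    ⟦⟧-Presented (app f ts) σ = cong′ f λ i → ⟦⟧-Presented (ts i) σ

    ⟦⟧-Presented-var : ∀ {n k R} (s : Term L (Fin n)) →
                       PresEq L V n k R (⟦_⟧ (Presented L V n k R) s var) s
    ⟦⟧-Presented-var s = trans′ (⟦⟧-Presented s var) (Derivable⇒PresEq (subst-var s))

    Presented∈V : ∀ {n k R} → _∈V_ L (Presented L V n k R) V
    Presented∈V e ρ =
      trans′ (⟦⟧-Presented (lhs V e) ρ) (trans′ (ax e ρ) (sym′ (⟦⟧-Presented (rhs V e) ρ)))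

setoid : {L : Signature} → Algebra L → Setoid _ _
setoid C = record { Carrier = Carrier C ; _≈_ = _≈_ C ; isEquivalence = isEquivalence C }

module Semantics {L : Signature} (C : Algebra L) where
  open Equational L
  open IsEquivalence (isEquivalence C) public
    renaming (refl to ≈-refl; sym to ≈-sym; trans to ≈-trans)

  ⟦⟧-cong : ∀ {X : Set} (s : Term L X) {ρ ρ′ : X → Carrier C} →
            (∀ x → _≈_ C (ρ x) (ρ′ x)) → _≈_ C (⟦_⟧ C s ρ) (⟦_⟧ C s ρ′)
  ⟦⟧-cong (var x)    ρ≈ρ′ = ρ≈ρ′ x
  ⟦⟧-cong (app f ts) ρ≈ρ′ = op-cong C f λ i → ⟦⟧-cong (ts i) ρ≈ρ′

  ⟦⟧-subst : ∀ {X Y : Set} (s : Term L X) (σ : X → Term L Y) (ρ : Y → Carrier C) →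
             _≈_ C (⟦_⟧ C (s [ σ ]) ρ) (⟦_⟧ C s (λ x → ⟦_⟧ C (σ x) ρ))
  ⟦⟧-subst (var x)    σ ρ = ≈-refl
  ⟦⟧-subst (app f ts) σ ρ = op-cong C f λ i → ⟦⟧-subst (ts i) σ ρ

  ⟦⟧-cons-η : ∀ {k} (s : Term L (Fin (suc k))) (ρ : Fin (suc k) → Carrier C) →
              _≈_ C (⟦_⟧ C s (cons (ρ zero) (λ i → ρ (suc i)))) (⟦_⟧ C s ρ)
  ⟦⟧-cons-η s ρ = ⟦⟧-cong s λ where
    zero    → ≈-refl
    (suc _) → ≈-refl

  sound : ∀ {V : Variety L} → _∈V_ L C V →
          ∀ {X I} {P : I → Term L X × Term L X} (ρ : X → Carrier C) →
          (∀ i → _≈_ C (⟦_⟧ C (proj₁ (P i)) ρ) (⟦_⟧ C (proj₂ (P i)) ρ)) →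
          ∀ {s r} → Derivable V P s r → _≈_ C (⟦_⟧ C s ρ) (⟦_⟧ C r ρ)
  sound {V} C∈V ρ P-holds (axiom e σ) =
    ≈-trans (⟦⟧-subst (lhs V e) σ ρ) (≈-trans (C∈V e _) (≈-sym (⟦⟧-subst (rhs V e) σ ρ)))
  sound C∈V ρ P-holds (assumption i) = P-holds i
  sound C∈V ρ P-holds refl           = ≈-refl
  sound C∈V ρ P-holds (sym p)        = ≈-sym (sound C∈V ρ P-holds p)
  sound C∈V ρ P-holds (trans p q)    = ≈-trans (sound C∈V ρ P-holds p) (sound C∈V ρ P-holds q)
  sound C∈V ρ P-holds (app-cong f p) = op-cong C f λ i → sound C∈V ρ P-holds (p i)

⟦⟧-hom : ∀ {L} {A B : Algebra L} (h : Hom L A B) {X : Set} (s : Term L X) (ρ : X → Carrier A) →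
         _≈_ B (fun h (⟦_⟧ A s ρ)) (⟦_⟧ B s (λ x → fun h (ρ x)))
⟦⟧-hom {B = B} h (var x)    ρ = Semantics.≈-refl B
⟦⟧-hom {B = B} h (app f ts) ρ =
  Semantics.≈-trans B (fun-hom h f _) (op-cong B f λ i → ⟦⟧-hom h (ts i) ρ)

module Semilattice {L : Signature} (V : Variety L) (J : Term L (Fin 2)) (isJoin : IsJoinTerm L V J)
                   (C : Algebra L) (C∈V : _∈V_ L C V) where
  open Semantics C

  infixr 6 _∨_
  infix 4 _⊑_
  _∨_ : Carrier C → Carrier C → Carrier C
  a ∨ b = ⟦_⟧ C J (pair a b)

  _⊑_ : Carrier C → Carrier C → Set
  _⊑_ = Leq L C J

  ∨-cong : ∀ {a a′ b b′} → _≈_ C a a′ → _≈_ C b b′ → _≈_ C (a ∨ b) (a′ ∨ b′)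
  ∨-cong a≈a′ b≈b′ = ⟦⟧-cong J λ where
    zero    → a≈a′
    (suc _) → b≈b′

  ⟦⟧-∨ : ∀ {X : Set} (s r : Term L X) ρ →
         _≈_ C (⟦_⟧ C (_∨⟨_⟩_ L s J r) ρ) (⟦_⟧ C s ρ ∨ ⟦_⟧ C r ρ)
  ⟦⟧-∨ s r ρ = ≈-trans (⟦⟧-subst J (pair s r) ρ) (⟦⟧-cong J λ where
    zero    → ≈-refl
    (suc _) → ≈-refl)

  ∨-idem : ∀ a → _≈_ C (a ∨ a) a
  ∨-idem a = ≈-trans (≈-sym (⟦⟧-∨ (v0 L) (v0 L) ρ)) (proj₁ isJoin C C∈V ρ)
    where ρ = cons a (pair a a)

  ∨-comm : ∀ a b → _≈_ C (a ∨ b) (b ∨ a)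
  ∨-comm a b = begin
    a ∨ b                            ≈⟨ ⟦⟧-∨ (v0 L) (v1 L) ρ ⟨
    ⟦_⟧ C (_∨⟨_⟩_ L (v0 L) J (v1 L)) ρ ≈⟨ proj₁ (proj₂ isJoin) C C∈V ρ ⟩
    ⟦_⟧ C (_∨⟨_⟩_ L (v1 L) J (v0 L)) ρ ≈⟨ ⟦⟧-∨ (v1 L) (v0 L) ρ ⟩
    b ∨ a                            ∎
    where
    open SetoidReasoning (setoid C)
    ρ = cons a (pair b b)

  ∨-assoc : ∀ a b c → _≈_ C ((a ∨ b) ∨ c) (a ∨ (b ∨ c))
  ∨-assoc a b c = begin
    (a ∨ b) ∨ c                       ≈⟨ ∨-cong (⟦⟧-∨ (v0 L) (v1 L) ρ) ≈-refl ⟨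
    ⟦_⟧ C (v0 L ∨ᵗ v1 L) ρ ∨ c          ≈⟨ ⟦⟧-∨ (v0 L ∨ᵗ v1 L) (v2 L) ρ ⟨
    ⟦_⟧ C ((v0 L ∨ᵗ v1 L) ∨ᵗ v2 L) ρ    ≈⟨ proj₂ (proj₂ isJoin) C C∈V ρ ⟩
    ⟦_⟧ C (v0 L ∨ᵗ (v1 L ∨ᵗ v2 L)) ρ    ≈⟨ ⟦⟧-∨ (v0 L) (v1 L ∨ᵗ v2 L) ρ ⟩
    a ∨ ⟦_⟧ C (v1 L ∨ᵗ v2 L) ρ          ≈⟨ ∨-cong ≈-refl (⟦⟧-∨ (v1 L) (v2 L) ρ) ⟩
    a ∨ (b ∨ c)                       ∎
    where
    open SetoidReasoning (setoid C)
    ρ = cons a (pair b c)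
    _∨ᵗ_ : Term L (Fin 3) → Term L (Fin 3) → Term L (Fin 3)
    s ∨ᵗ r = _∨⟨_⟩_ L s J r

  ⊑-refl : ∀ {a} → a ⊑ a
  ⊑-refl = ∨-idem _

  ⊑-trans : ∀ {a b c} → a ⊑ b → b ⊑ c → a ⊑ c
  ⊑-trans {a} {b} {c} a⊑b b⊑c = begin
    a ∨ c        ≈⟨ ∨-cong ≈-refl b⊑c ⟨
    a ∨ (b ∨ c)  ≈⟨ ∨-assoc a b c ⟨
    (a ∨ b) ∨ c  ≈⟨ ∨-cong a⊑b ≈-refl ⟩
    b ∨ c        ≈⟨ b⊑c ⟩
    c            ∎
    where open SetoidReasoning (setoid C)

  ⊑-antisym : ∀ {a b} → a ⊑ b → b ⊑ a → _≈_ C a b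
  ⊑-antisym {a} {b} a⊑b b⊑a = ≈-trans (≈-sym b⊑a) (≈-trans (∨-comm b a) a⊑b)

  ⊑-respˡ-≈ : ∀ {a a′ b} → _≈_ C a a′ → a′ ⊑ b → a ⊑ b
  ⊑-respˡ-≈ a≈a′ a′⊑b = ≈-trans (∨-cong a≈a′ ≈-refl) a′⊑b

  ⊑-respʳ-≈ : ∀ {a b b′} → _≈_ C b b′ → a ⊑ b′ → a ⊑ b
  ⊑-respʳ-≈ b≈b′ a⊑b′ = ≈-trans (∨-cong ≈-refl b≈b′) (≈-trans a⊑b′ (≈-sym b≈b′))

Iso-refl : ∀ {L} (A : Algebra L) → Iso L A A
Iso-refl A = record
  { to      = id-hom
  ; from    = id-hom
  ; to-from = λ _ → Semantics.≈-refl A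
  ; from-to = λ _ → Semantics.≈-refl A
  }
  where
  id-hom : Hom _ A A
  id-hom = record { fun = λ a → a ; fun-cong = λ a≈b → a≈b ; fun-hom = λ _ _ → Semantics.≈-refl A }

module _ {L : Signature} (V : Variety L) where
  open Equational L

  Kernel : ∀ {n k} (R : Fin k → Term L (Fin n) × Term L (Fin n)) {n′} (g : Fin n′ → Term L (Fin n)) →
           Term L (Fin n′) → Term L (Fin n′) → Set
  Kernel {n} {k} R g s r = PresEq L V n k R (s [ g ]) (r [ g ])

  -- The Tietze argument: transport a finite presentation of the subalgebra generated by g
  -- along the isomorphism and add the relations identifying each generator with its image.
  coherent⇒kernel-finitelyGenerated :
    Coherent L V → ∀ {n k} (R : Fin k → Term L (Fin n) × Term L (Fin n)) {n′} (g : Fin n′ → Term L (Fin n)) →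
    Σ[ K ∈ ℕ ] Σ[ G ∈ (Fin K ⊎ Fin n′ → Term L (Fin n′) × Term L (Fin n′)) ]
      ((∀ i → Kernel R g (proj₁ (G i)) (proj₂ (G i))) × (∀ {s r} → Kernel R g s r → Derivable V G s r))
  coherent⇒kernel-finitelyGenerated coherent {n} {k} R {n′} g = K , G , G⊆kernel , kernel⊆G
    where
    A = Presented L V n k R
    S = Sg L A g
    presentation = coherent A (n , k , R , Iso-refl A) n′ g
    n″ = proj₁ presentation
    K  = proj₁ (proj₂ presentation)
    R″ = proj₁ (proj₂ (proj₂ presentation))
    S≅P = proj₂ (proj₂ (proj₂ presentation))
    P = Presented L V n″ K R″
    to = Iso.to S≅P
    from = Iso.from S≅P

    element : Term L (Fin n′) → Carrier S
    element s = ⟦_⟧ A s g , s , refl′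

    preimage : Fin n″ → Term L (Fin n′)
    preimage j = proj₁ (proj₂ (fun from (var j)))

    image : Fin n′ → Term L (Fin n″)
    image i = fun to (element (var i))

    G : Fin K ⊎ Fin n′ → Term L (Fin n′) × Term L (Fin n′)
    G (inj₁ i) = proj₁ (R″ i) [ preimage ] , proj₂ (R″ i) [ preimage ]
    G (inj₂ i) = image i [ preimage ] , var i

    ⟦⟧-Sg : ∀ {Y : Set} (u : Term L Y) (σ : Y → Carrier S) →
            PresEq L V n k R (proj₁ (⟦_⟧ S u σ)) (⟦_⟧ A u (λ y → proj₁ (σ y)))
    ⟦⟧-Sg (var y)    σ = refl′
    ⟦⟧-Sg (app f ts) σ = cong′ f λ i → ⟦⟧-Sg (ts i) σ

    from-term : ∀ u → PresEq L V n k R (proj₁ (fun from u)) (u [ preimage ] [ g ])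
    from-term u = begin
      proj₁ (fun from u)                              ≈⟨ fun-cong from (sym′ (⟦⟧-Presented-var u)) ⟩
      proj₁ (fun from (⟦_⟧ P u var))                  ≈⟨ ⟦⟧-hom from u var ⟩
      proj₁ (⟦_⟧ S u (λ j → fun from (var j)))         ≈⟨ ⟦⟧-Sg u _ ⟩
      ⟦_⟧ A u (λ j → proj₁ (fun from (var j)))         ≈⟨ ⟦⟧-cong u (λ j → proj₂ (proj₂ (fun from (var j)))) ⟩
      ⟦_⟧ A u (λ j → ⟦_⟧ A (preimage j) g)             ≈⟨ ⟦⟧-subst u preimage g ⟨
      ⟦_⟧ A (u [ preimage ]) g                          ≈⟨ ⟦⟧-Presented (u [ preimage ]) g ⟩
      u [ preimage ] [ g ]                              ∎
      where open SetoidReasoning (setoid A)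
            open Semantics A

    to-term : ∀ s → PresEq L V n″ K R″ (fun to (element s)) (s [ image ])
    to-term s = begin
      fun to (element s)                        ≈⟨ fun-cong to (sym′ (⟦⟧-Sg s (λ i → element (var i)))) ⟩
      fun to (⟦_⟧ S s (λ i → element (var i)))  ≈⟨ ⟦⟧-hom to s _ ⟩
      ⟦_⟧ P s image                             ≈⟨ ⟦⟧-Presented s image ⟩
      s [ image ]                               ∎
      where open SetoidReasoning (setoid P)

    G⊆kernel : ∀ i → Kernel R g (proj₁ (G i)) (proj₂ (G i))
    G⊆kernel (inj₁ i) =
      trans′ (sym′ (from-term (proj₁ (R″ i)))) (trans′ (fun-cong from (gen i)) (from-term (proj₂ (R″ i))))
    G⊆kernel (inj₂ i) = trans′ (sym′ (from-term (image i))) (Iso.from-to S≅P (element (var i)))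

    kernel⊆G : ∀ {s r} → Kernel R g s r → Derivable V G s r
    kernel⊆G {s} {r} s≈r = begin
      s                                  ≈⟨ subst-var s ⟨
      s [ var ]                          ≈⟨ subst-cong s (λ i → assumption (inj₂ i)) ⟨
      s [ (λ i → image i [ preimage ]) ] ≈⟨ subst-assoc s image preimage ⟨
      s [ image ] [ preimage ]           ≈⟨ Derivable-subst preimage (λ i → assumption (inj₁ i))
                                                            (PresEq⇒Derivable s≈r[image]) ⟩
      r [ image ] [ preimage ]           ≈⟨ subst-assoc r image preimage ⟩
      r [ (λ i → image i [ preimage ]) ] ≈⟨ subst-cong r (λ i → assumption (inj₂ i)) ⟩
      r [ var ]                          ≈⟨ subst-var r ⟩
      r                                  ∎
      where
      open SetoidReasoning (Derivable-setoid V G)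
      element-s≈r : _≈_ S (element s) (element r)
      element-s≈r = trans′ (⟦⟧-Presented s g) (trans′ s≈r (sym′ (⟦⟧-Presented r g)))
      s≈r[image] : PresEq L V n″ K R″ (s [ image ]) (r [ image ])
      s≈r[image] = trans′ (sym′ (to-term s)) (trans′ (fun-cong to element-s≈r) (to-term r))

module _ {L : Signature} (V : Variety L) (J : Term L (Fin 2)) {m : ℕ} (t : Term L (Fin (suc m))) where

  Inflationary : Set₁
  Inflationary = _⊨_≈ᵗ_ L V (_∨⟨_⟩_ L (var zero) J t) t

  Monotone : Set₁
  Monotone = ∀ (A : Algebra L) → _∈V_ L A V →
             ∀ (a c : Carrier A) (b : Fin m → Carrier A) →
             Leq L A J a c → Leq L A J (⟦_⟧ A t (cons a b)) (⟦_⟧ A t (cons c b))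

module Iterates {L : Signature} (V : Variety L) (J : Term L (Fin 2)) (isJoin : IsJoinTerm L V J)
                {m : ℕ} (t : Term L (Fin (suc m))) (C : Algebra L) (C∈V : _∈V_ L C V) where
  open Semantics C
  open Semilattice V J isJoin C C∈V

  ⟦iter-suc⟧ : ∀ k (ρ : Fin (suc m) → Carrier C) →
               _≈_ C (⟦_⟧ C (iter L t (suc k)) ρ) (⟦_⟧ C t (cons (⟦_⟧ C (iter L t k) ρ) (λ i → ρ (suc i))))
  ⟦iter-suc⟧ k ρ = ≈-trans (⟦⟧-subst t (cons (iter L t k) (λ i → var (suc i))) ρ) (⟦⟧-cong t λ where
    zero    → ≈-refl
    (suc _) → ≈-refl)

  iter-ascending : Inflationary V J t → ∀ ρ k → ⟦_⟧ C (iter L t k) ρ ⊑ ⟦_⟧ C (iter L t (suc k)) ρ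
  iter-ascending inflationary ρ k =
    ⊑-respʳ-≈ (⟦iter-suc⟧ k ρ) (≈-trans (≈-sym (⟦⟧-∨ (var zero) t ρ′)) (inflationary C C∈V ρ′))
    where ρ′ = cons (⟦_⟧ C (iter L t k) ρ) (λ i → ρ (suc i))

  iter-monotone : Inflationary V J t → ∀ ρ {i j} → i ≤ j → ⟦_⟧ C (iter L t i) ρ ⊑ ⟦_⟧ C (iter L t j) ρ
  iter-monotone inflationary ρ =
    ascending⇒monotone {_≲_ = _⊑_} ⊑-refl ⊑-trans (λ k → ⟦_⟧ C (iter L t k) ρ) (iter-ascending inflationary ρ)

  iter-below-prefixpoint : Monotone V J t → ∀ (ρ : Fin (suc m) → Carrier C) {y} →
                           ρ zero ⊑ y → ⟦_⟧ C t (cons y (λ i → ρ (suc i))) ⊑ y →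
                           ∀ k → ⟦_⟧ C (iter L t k) ρ ⊑ y
  iter-below-prefixpoint monotone ρ ρ₀⊑y t[y]⊑y zero    = ρ₀⊑y
  iter-below-prefixpoint monotone ρ ρ₀⊑y t[y]⊑y (suc k) =
    ⊑-respˡ-≈ (⟦iter-suc⟧ k ρ)
      (⊑-trans (monotone C C∈V _ _ _ (iter-below-prefixpoint monotone ρ ρ₀⊑y t[y]⊑y k)) t[y]⊑y)

module Stabilisation {L : Signature} (V : Variety L) (J : Term L (Fin 2)) (isJoin : IsJoinTerm L V J)
                     {m : ℕ} (t : Term L (Fin (suc m))) where
  open Equational L

  n′ : ℕ
  n′ = suc (suc m)

  shift : ∀ {k} → Fin k → Term L (Fin (suc k))
  shift i = var (suc i)

  z x : Term L (Fin n′)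
  z = var zero
  x = var (suc zero)

  ū : Fin m → Term L (Fin n′)
  ū i = var (suc (suc i))

  t^ : ℕ → Term L (Fin n′)
  t^ k = iter L t k [ shift ]

  ⟦t^⟧ : ∀ (C : Algebra L) (ρ : Fin n′ → Carrier C) k →
         _≈_ C (⟦_⟧ C (t^ k) ρ) (⟦_⟧ C (iter L t k) (λ i → ρ (suc i)))
  ⟦t^⟧ C ρ k = Semantics.⟦⟧-subst C (iter L t k) shift ρ

  infixr 6 _∨ᵗ_
  infix 5 _≤ᵗ_
  _∨ᵗ_ : ∀ {X : Set} → Term L X → Term L X → Term L X
  s ∨ᵗ r = _∨⟨_⟩_ L s J r

  _≤ᵗ_ : ∀ {X : Set} → Term L X → Term L X → Term L X × Term L X
  s ≤ᵗ r = s ∨ᵗ r , r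

  below-z : ∀ N → Σ[ i ∈ ℕ ] i ≤ N → Term L (Fin n′) × Term L (Fin n′)
  below-z N (i , _) = t^ i ≤ᵗ z

  Ψ : ℕ → Term L (Fin n′) → Term L (Fin n′) → Set
  Ψ N = Derivable V (below-z N)

  Ψ-mono : ∀ {N N′ s r} → N ≤ N′ → Ψ N s r → Ψ N′ s r
  Ψ-mono N≤N′ = Derivable-mono λ where (i , i≤N) → assumption (i , ≤-trans i≤N N≤N′)

  Q : Algebra L
  Q = record
    { Carrier       = Term L (Fin n′)
    ; _≈_           = λ s r → Σ[ N ∈ ℕ ] Ψ N s r
    ; isEquivalence = record
      { refl  = 0 , refl
      ; sym   = λ where (N , p) → N , sym p
      ; trans = λ where
          (N , p) (N′ , q) → N ⊔ N′ , trans (Ψ-mono (m≤m⊔n N N′) p) (Ψ-mono (m≤n⊔m N N′) q)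
      }
    ; op            = app
    ; op-cong       = λ f ps →
        let N , p = Fin-commonBound _ (λ _ → Ψ-mono) ps in N , app-cong f p
    }

  ⟦⟧-Q : ∀ {Y : Set} (s : Term L Y) (σ : Y → Term L (Fin n′)) → Ψ 0 (⟦_⟧ Q s σ) (s [ σ ])
  ⟦⟧-Q (var y)    σ = refl
  ⟦⟧-Q (app f ts) σ = app-cong f λ i → ⟦⟧-Q (ts i) σ

  ⟦⟧-Q-var : ∀ s → _≈_ Q (⟦_⟧ Q s var) s
  ⟦⟧-Q-var s = 0 , trans (⟦⟧-Q s var) (subst-var s)

  Q∈V : _∈V_ L Q V
  Q∈V e ρ = 0 , trans (⟦⟧-Q (lhs V e) ρ) (trans (axiom e ρ) (sym (⟦⟧-Q (rhs V e) ρ)))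

  Q-finGen : FinGen L Q
  Q-finGen = n′ , var , λ s → s , Semantics.≈-sym Q (⟦⟧-Q-var s)

  stabilises : Inflationary V J t → ∀ N → Ψ N (t^ (suc N) ∨ᵗ z) z → _⊨_≈ᵗ_ L V (iter L t N) (iter L t (suc N))
  stabilises inflationary N t^N+1⊑z C C∈V ρ =
    ⊑-antisym (iter-ascending inflationary ρ N)
              (⊑-respˡ-≈ (≈-sym (⟦t^⟧ C ρ′ (suc N)))
                (≈-trans (≈-sym (⟦⟧-∨ (t^ (suc N)) z ρ′)) (sound C∈V ρ′ below-z-holds t^N+1⊑z)))
    where
    open Semantics C
    open Semilattice V J isJoin C C∈V
    open Iterates V J isJoin t C C∈V
    -- z is interpreted as t^N, which lies above every t^i with i ≤ N.
    ρ′ = cons (⟦_⟧ C (iter L t N) ρ) ρ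
    below-z-holds : ∀ i → _≈_ C (⟦_⟧ C (proj₁ (below-z N i)) ρ′) (⟦_⟧ C (proj₂ (below-z N i)) ρ′)
    below-z-holds (i , i≤N) =
      ≈-trans (⟦⟧-∨ (t^ i) z ρ′) (≈-trans (∨-cong (⟦t^⟧ C ρ′ i) ≈-refl) (iter-monotone inflationary ρ i≤N))

  y : Term L (Fin (suc n′))
  y = var zero

  R : Fin 3 → Term L (Fin (suc n′)) × Term L (Fin (suc n′))
  R zero             = x [ shift ] ≤ᵗ y
  R (suc zero)       = t [ cons y (λ i → ū i [ shift ]) ] ≤ᵗ y
  R (suc (suc zero)) = y ≤ᵗ z [ shift ]

  A : Algebra L
  A = Presented L V (suc n′) 3 R

  iterates-below : Monotone V J t → ∀ k → Kernel V R shift (t^ k ∨ᵗ z) z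
  iterates-below monotone k = begin
    (t^ k ∨ᵗ z) [ shift ]                                  ≈⟨ ⟦⟧-Presented (t^ k ∨ᵗ z) shift ⟨
    ⟦_⟧ A (t^ k ∨ᵗ z) shift                                ≈⟨ ⟦⟧-∨ (t^ k) z shift ⟩
    ⟦_⟧ A (t^ k) shift ∨ z [ shift ]                       ≈⟨ ∨-cong (⟦t^⟧ A shift k) refl′ ⟩
    ⟦_⟧ A (iter L t k) (λ i → shift (suc i)) ∨ z [ shift ] ≈⟨ ⊑-trans t^k⊑y (relation (gen (suc (suc zero)))) ⟩
    z [ shift ]                                            ∎
    where
    open SetoidReasoning (setoid A)
    open Semilattice V J isJoin A Presented∈V
    open Iterates V J isJoin t A Presented∈V
    relation : ∀ {a b} → _≈_ A (a ∨ᵗ b) b → a ⊑ b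
    relation = trans′ (⟦⟧-Presented J _)
    t^k⊑y : ⟦_⟧ A (iter L t k) (λ i → shift (suc i)) ⊑ y
    t^k⊑y = iter-below-prefixpoint monotone _ (relation (gen zero))
              (⊑-respˡ-≈ (⟦⟧-Presented t _) (relation (gen (suc zero)))) k

  -- Sending y to the fixpoint ŷ validates the relations of A, and hence every relation among z, x, ū in A.
  kernel⊆Ψ : FixpointEmbedding L V J t → ∀ {s r} → Kernel V R shift s r → Σ[ N ∈ ℕ ] Ψ N s r
  kernel⊆Ψ fixpoint-embedding {s} {r} s≈r with fixpoint-embedding Q Q∈V Q-finGen x ū
  ... | B , B∈V , h , h-injective , ŷ , (ŷ-upper , ŷ-least) , ŷ-fixed = h-injective s r (begin
    fun h s                           ≈⟨ h-⟦⟧ s ⟩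
    ⟦_⟧ B s (λ j → fun h (var j))     ≈⟨ ⟦⟧-subst s shift ρ ⟨
    ⟦_⟧ B (s [ shift ]) ρ             ≈⟨ sound B∈V ρ relations-hold (PresEq⇒Derivable s≈r) ⟩
    ⟦_⟧ B (r [ shift ]) ρ             ≈⟨ ⟦⟧-subst r shift ρ ⟩
    ⟦_⟧ B r (λ j → fun h (var j))     ≈⟨ h-⟦⟧ r ⟨
    fun h r                           ∎)
    where
    open SetoidReasoning (setoid B)
    open Semantics B
    open Semilattice V J isJoin B B∈V

    ρ : Fin (suc n′) → Carrier B
    ρ = cons ŷ (λ j → fun h (var j))

    h-⟦⟧ : ∀ u → _≈_ B (fun h u) (⟦_⟧ B u (λ j → fun h (var j)))
    h-⟦⟧ u = ≈-trans (fun-cong h (Semantics.≈-sym Q (⟦⟧-Q-var u))) (⟦⟧-hom h u var)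

    iterates-below-z : ∀ k → ⟦_⟧ B (iter L t k) (cons (fun h x) (λ i → fun h (ū i))) ⊑ fun h z
    iterates-below-z k = begin
      ⟦_⟧ B (iter L t k) (cons (fun h x) (λ i → fun h (ū i))) ∨ fun h z ≈⟨ ∨-cong (⟦⟧-cons-η (iter L t k) _) ≈-refl ⟩
      ⟦_⟧ B (iter L t k) (λ i → fun h (var (suc i))) ∨ fun h z         ≈⟨ ∨-cong (⟦t^⟧ B _ k) ≈-refl ⟨
      ⟦_⟧ B (t^ k) (λ j → fun h (var j)) ∨ fun h z                     ≈⟨ ⟦⟧-∨ (t^ k) z _ ⟨
      ⟦_⟧ B (t^ k ∨ᵗ z) (λ j → fun h (var j))                          ≈⟨ h-⟦⟧ (t^ k ∨ᵗ z) ⟨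
      fun h (t^ k ∨ᵗ z)                                                 ≈⟨ fun-cong h (k , assumption (k , ≤-refl)) ⟩
      fun h z                                                           ∎

    relations-hold : ∀ i → _≈_ B (⟦_⟧ B (proj₁ (R i)) ρ) (⟦_⟧ B (proj₂ (R i)) ρ)
    relations-hold zero = ≈-trans (⟦⟧-∨ (x [ shift ]) y ρ) (ŷ-upper 0)
    relations-hold (suc zero) = begin
      ⟦_⟧ B (t [ yū ] ∨ᵗ y) ρ                       ≈⟨ ⟦⟧-∨ (t [ yū ]) y ρ ⟩
      ⟦_⟧ B (t [ yū ]) ρ ∨ ŷ                        ≈⟨ ∨-cong (⟦⟧-subst t yū ρ) ≈-refl ⟩
      ⟦_⟧ B t (λ j → ⟦_⟧ B (yū j) ρ) ∨ ŷ            ≈⟨ ∨-cong (⟦⟧-cons-η t _) ≈-refl ⟨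
      ⟦_⟧ B t (cons ŷ (λ i → fun h (ū i))) ∨ ŷ      ≈⟨ ∨-cong ŷ-fixed ≈-refl ⟨
      ŷ ∨ ŷ                                         ≈⟨ ∨-idem ŷ ⟩
      ŷ                                             ∎
      where yū = cons y (λ i → ū i [ shift ])
    relations-hold (suc (suc zero)) = ≈-trans (⟦⟧-∨ y (z [ shift ]) ρ) (ŷ-least (fun h z) iterates-below-z)

theorem3p1 : (L : Signature) (V : Variety L) →
    Σ[ c ∈ Op L ] (ar L c ≡ 0) →
    Coherent L V →
    (J : Term L (Fin 2)) → IsJoinTerm L V J →
    (m : ℕ) (t : Term L (Fin (suc m))) →
    (_⊨_≈ᵗ_ L V (_∨⟨_⟩_ L (var zero) J t) t) →
    (∀ (A : Algebra L) → _∈V_ L A V →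
    ∀ (a c : Carrier A) (b : Fin m → Carrier A) →
    Leq L A J a c →
    Leq L A J (⟦_⟧ A t (cons a b)) (⟦_⟧ A t (cons c b))) →
    FixpointEmbedding L V J t →
    Σ[ n ∈ ℕ ] (_⊨_≈ᵗ_ L V (iter L t n) (iter L t (suc n)))
theorem3p1 L V _ coherent J isJoin m t inflationary monotone fixpoint-embedding =
  let open Equational L
      open Stabilisation V J isJoin t
      (K , G , G⊆kernel , kernel⊆G) = coherent⇒kernel-finitelyGenerated V coherent R shift
      (N , G⊆Ψ) = ⊎-commonBound (Fin-commonBound K) (Fin-commonBound n′) (λ _ → Ψ-mono)
                    (λ i → kernel⊆Ψ fixpoint-embedding (G⊆kernel i))
  in N , stabilises inflationary N (Derivable-mono G⊆Ψ (kernel⊆G (iterates-below monotone (suc N))))
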